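{- Let $A\subseteq\omega$ have intrinsic density $\frac12$. Then $A\oplus\overline{A}$ has intrinsic density $\frac12$, but $A\triangleright(A\oplus\overline{A})$ does not have intrinsic density.
   Context: $\overline{A}=\omega\setminus A$; $X\oplus Y=\{2n:n\in X\}\cup\{2n+1:n\in Y\}$. For $S=\{s_0<s_1<\cdots\}$, $B\triangleright S=\{s_{b_n}:n\in\omega\}$, the elements of $S$ whose index in increasing order lies in $B$. $\rho_n(S)=|S\cap\{0,\dots,n-1\}|/n$, $\rho(S)=\lim_n\rho_n(S)$ when it exists. $S$ has intrinsic density $\gamma$ if $\rho(\pi(S))=\gamma$ for every computable permutation $\pi$; $S$ "has intrinsic density" if it has intrinsic density $\gamma$ for some $\gamma$. -}

module Defs where

open import Data.Nat using (ℕ; zero; suc; _<_; _≤_)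
open import Data.Bool using (Bool; true; false; not; _∧_; if_then_else_)
open import Data.Fin using (Fin)
open import Data.Vec using (Vec; []; _∷_; lookup)
open import Data.Product using (Σ; _×_; _,_)
open import Data.Integer using (+_)
open import Data.Rational.Unnormalised using (ℚᵘ; mkℚᵘ; _-_; ∣_∣) renaming (_<_ to _<ℚ_)
open import Relation.Binary.PropositionalEquality using (_≡_)
open import Relation.Nullary using (¬_)

data Code : ℕ → Set where
  cZ    : ∀ {n} → Code n
  cS    : Code 1
  cP    : ∀ {n} → Fin n → Code n
  cComp : ∀ {m n} → Code m → (Fin m → Code n) → Code n
  cRec  : ∀ {n} → Code n → Code (suc (suc n)) → Code (suc n)
  cMin  : ∀ {n} → Code (suc n) → Code n

data Eval : ∀ {n} → Code n → Vec ℕ n → ℕ → Set where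
  eZ    : ∀ {n} {xs : Vec ℕ n} → Eval cZ xs 0
  eS    : ∀ {x} → Eval cS (x ∷ []) (suc x)
  eP    : ∀ {n} {i : Fin n} {xs} → Eval (cP i) xs (lookup xs i)
  eComp : ∀ {m n} {g : Code m} {hs : Fin m → Code n} {xs : Vec ℕ n} {ys : Vec ℕ m} {z} →
          (∀ i → Eval (hs i) xs (lookup ys i)) → Eval g ys z → Eval (cComp g hs) xs z
  eRec0 : ∀ {n} {f : Code n} {g} {xs : Vec ℕ n} {z} →
          Eval f xs z → Eval (cRec f g) (0 ∷ xs) z
  eRecS : ∀ {n} {f : Code n} {g} {xs : Vec ℕ n} {k y z} →
          Eval (cRec f g) (k ∷ xs) y → Eval g (k ∷ y ∷ xs) z →
          Eval (cRec f g) (suc k ∷ xs) z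
  eMin  : ∀ {n} {f : Code (suc n)} {xs : Vec ℕ n} {y} →
          Eval f (y ∷ xs) 0 →
          (∀ k → k < y → Σ ℕ (λ v → Eval f (k ∷ xs) (suc v))) →
          Eval (cMin f) xs y

Computable : (ℕ → ℕ) → Set
Computable f = Σ (Code 1) (λ e → ∀ n → Eval e (n ∷ []) (f n))

record CompPerm : Set where
  field
    fun      : ℕ → ℕ
    inv      : ℕ → ℕ
    inv-fun  : ∀ n → inv (fun n) ≡ n
    fun-inv  : ∀ n → fun (inv n) ≡ n
    computable : Computable fun
open CompPerm public

Set𝟚 : Set
Set𝟚 = ℕ → Bool

∁ : Set𝟚 → Set𝟚
∁ A n = not (A n)

-- X ⊕ Y = {2n : n ∈ X} ∪ {2n+1 : n ∈ Y}
_⊕_ : Set𝟚 → Set𝟚 → Set𝟚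
(X ⊕ Y) zero = X zero
(X ⊕ Y) (suc zero) = Y zero
(X ⊕ Y) (suc (suc n)) = ((λ k → X (suc k)) ⊕ (λ k → Y (suc k))) n

count : Set𝟚 → ℕ → ℕ
count S zero = 0
count S (suc n) = if S n then suc (count S n) else count S n

-- B ▷ S = { s_b : b ∈ B }: x ∈ B ▷ S iff x ∈ S and x's index in S
-- (namely |S ∩ [0,x)|) lies in B.
_▷_ : Set𝟚 → Set𝟚 → Set𝟚
(B ▷ S) x = S x ∧ B (count S x)

image : CompPerm → Set𝟚 → Set𝟚
image π S m = S (inv π m)

-- ρ_{n+1}(S) = |S ∩ {0,…,n}| / (n+1)
ρ₁₊ : Set𝟚 → ℕ → ℚᵘ
ρ₁₊ S n = mkℚᵘ (+ count S (suc n)) n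

inv₁₊ : ℕ → ℚᵘ
inv₁₊ k = mkℚᵘ (+ 1) k

HasDensity : Set𝟚 → ℚᵘ → Set
HasDensity S γ = ∀ k → Σ ℕ (λ N → ∀ n → N ≤ n → ∣ ρ₁₊ S n - γ ∣ <ℚ inv₁₊ k)

HasIntrinsicDensity : Set𝟚 → ℚᵘ → Set
HasIntrinsicDensity S γ = ∀ (π : CompPerm) → HasDensity (image π S) γ

-- S has intrinsic density γ for some real γ.  (No reals in stdlib:
-- equivalently, for all computable π, π' the sequences ρ_n(π S), ρ_n(π' S)
-- are jointly Cauchy, i.e. each converges and all limits coincide.)
HasSomeIntrinsicDensity : Set𝟚 → Set
HasSomeIntrinsicDensity S =
  ∀ (π π' : CompPerm) (k : ℕ) → Σ ℕ (λ N → ∀ n m → N ≤ n → N ≤ m →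
      ∣ ρ₁₊ (image π S) n - ρ₁₊ (image π' S) m ∣ <ℚ inv₁₊ k)

module Submission where

-- A computable permutation π is relativised to the evens and to the odds:
-- σ_b sends n to the rank of π(2n + b) inside π(2ℕ + b).  These are again computable
-- permutations, and counting π(A ⊕ Ā) below N splits into counting σ₀(A) and σ₁(Ā) = ∁ σ₁(A)
-- below c₀ and c₁ with c₀ + c₁ = N.  Writing deviation S n = ∣ 2·|S ∩ [0,n)| − n ∣, the
-- deviations add up, and each summand is eventually small since σ₀(A), σ₁(A) have density ½.
-- Second half.  S = A ▷ (A ⊕ Ā) is A placed on the even numbers, so S has count A (6t) ≈ 3t
-- elements below 12t.  The computable permutation τ, which sends the odd numbers to the
-- multiples of 3 and the even numbers in order to the rest, gives τ(S) count A (8t) ≈ 4t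
-- elements there; so the densities of S and τ(S) cannot have a common limit.

open import Defs
open import Data.Nat
open import Data.Nat.Properties
open import Data.Nat.Tactic.RingSolver using (solve-∀)
open import Algebra.Properties.CommutativeSemigroup +-commutativeSemigroup using (x∙yz≈y∙xz)
open import Algebra.Properties.CommutativeSemigroup *-commutativeSemigroup using (xy∙z≈xz∙y)
open import Data.Bool using (Bool; true; false; not; if_then_else_; _∧_)
open import Data.Bool.Properties using (∧-idem)
open import Data.Fin using (Fin; zero; suc; toℕ; fromℕ<)
import Data.Fin.Properties as Fin
open import Data.Vec using (Vec; []; _∷_; lookup)
open import Data.Product using (Σ; _×_; _,_; proj₁; proj₂)
open import Data.Sum using (inj₁; inj₂)
open import Data.Empty using (⊥; ⊥-elim)
import Data.Integer as ℤ
import Data.Integer.Properties as ℤ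
open import Data.Sign using (Sign)
open import Data.Rational.Unnormalised using (½; *<*) renaming (_<_ to _<ℚ_)
import Data.Rational.Unnormalised as ℚ
open import Relation.Binary using (tri<; tri≈; tri>)
open import Relation.Binary.PropositionalEquality
open import Relation.Nullary using (¬_; yes; no)

bit : Bool → ℕ
bit false = 0
bit true  = 1

bit-not : ∀ b → bit (not b) ≡ 1 ∸ bit b
bit-not false = refl
bit-not true  = refl

Computes : ∀ {n} → Code n → (Vec ℕ n → ℕ) → Set
Computes {n} c F = (xs : Vec ℕ n) → Eval c xs (F xs)

Computes₁ : Code 1 → (ℕ → ℕ) → Set
Computes₁ c f = Computes c (λ xs → f (lookup xs zero))

Computes₂ : Code 2 → (ℕ → ℕ → ℕ) → Set
Computes₂ c f = Computes c (λ xs → f (lookup xs zero) (lookup xs (suc zero)))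

Computes₃ : Code 3 → (ℕ → ℕ → ℕ → ℕ) → Set
Computes₃ c f = Computes c (λ xs → f (lookup xs zero) (lookup xs (suc zero)) (lookup xs (suc (suc zero))))

toComputable : ∀ {c f} → Computes₁ c f → Computable f
toComputable {c} h = c , λ n → h (n ∷ [])

computes-ext : ∀ {n} {c : Code n} {F G : Vec ℕ n → ℕ} →
               Computes c F → (∀ xs → F xs ≡ G xs) → Computes c G
computes-ext {c = c} h F≡G xs = subst (Eval c xs) (F≡G xs) (h xs)

app₁ : ∀ {n} → Code 1 → Code n → Code n
app₁ g a = cComp g (λ { zero → a })

app₂ : ∀ {n} → Code 2 → Code n → Code n → Code n
app₂ g a b = cComp g (λ { zero → a ; (suc zero) → b })

compose₁ : ∀ {n} {g a} {G : Vec ℕ 1 → ℕ} {F : Vec ℕ n → ℕ} →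
           Computes g G → Computes a F → Computes (app₁ g a) (λ xs → G (F xs ∷ []))
compose₁ {F = F} hg ha xs = eComp {ys = F xs ∷ []} (λ { zero → ha xs }) (hg _)

compose₂ : ∀ {n} {g a b} {G : Vec ℕ 2 → ℕ} {F₁ F₂ : Vec ℕ n → ℕ} →
           Computes g G → Computes a F₁ → Computes b F₂ →
           Computes (app₂ g a b) (λ xs → G (F₁ xs ∷ F₂ xs ∷ []))
compose₂ {F₁ = F₁} {F₂} hg ha hb xs =
  eComp {ys = F₁ xs ∷ F₂ xs ∷ []} (λ { zero → ha xs ; (suc zero) → hb xs }) (hg _)

successor : Computes₁ cS suc
successor (x ∷ []) = eS

projection : ∀ {n} (i : Fin n) → Computes (cP i) (λ xs → lookup xs i)
projection i xs = eP

const : ∀ {n} → ℕ → Code n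
const zero    = cZ
const (suc m) = app₁ cS (const m)

const-computes : ∀ {n} m → Computes (const {n} m) (λ _ → m)
const-computes zero    xs = eZ
const-computes (suc m) = compose₁ successor (const-computes m)

recursion₁ : ∀ {z : Code 0} {s : Code 2} (f : ℕ → ℕ) (step : ℕ → ℕ → ℕ) →
             Eval z [] (f 0) → Computes₂ s step → (∀ k → f (suc k) ≡ step k (f k)) →
             Computes₁ (cRec z s) f
recursion₁ f step base hs eq (zero  ∷ []) = eRec0 base
recursion₁ {s = s} f step base hs eq (suc k ∷ []) =
  eRecS (recursion₁ f step base hs eq (k ∷ [])) (subst (Eval s _) (sym (eq k)) (hs _))

recursion₂ : ∀ {z : Code 1} {s : Code 3} (f : ℕ → ℕ → ℕ) (step : ℕ → ℕ → ℕ → ℕ) →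
             Computes₁ z (f 0) → Computes₃ s step → (∀ k x → f (suc k) x ≡ step k (f k x) x) →
             Computes₂ (cRec z s) f
recursion₂ f step hz hs eq (zero  ∷ x ∷ []) = eRec0 (hz (x ∷ []))
recursion₂ {s = s} f step hz hs eq (suc k ∷ x ∷ []) =
  eRecS (recursion₂ f step hz hs eq (k ∷ x ∷ [])) (subst (Eval s _) (sym (eq k x)) (hs _))

addC : Code 2
addC = cRec (cP zero) (app₁ cS (cP (suc zero)))

add-computes : Computes₂ addC _+_
add-computes = recursion₂ _+_ (λ _ y _ → suc y) (projection zero)
                 (compose₁ successor (projection (suc zero))) (λ _ _ → refl)

predC : Code 1
predC = cRec cZ (cP zero)

pred-computes : Computes₁ predC pred
pred-computes = recursion₁ pred (λ k _ → k) eZ (projection zero) (λ _ → refl)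

monusC : Code 2
monusC = cRec (cP zero) (app₁ predC (cP (suc zero)))

monus-computes : Computes₂ monusC (λ y x → x ∸ y)
monus-computes = recursion₂ (λ y x → x ∸ y) (λ _ r _ → pred r) (projection zero)
                   (compose₁ pred-computes (projection (suc zero)))
                   (λ k x → sym (pred[m∸n]≡m∸[1+n] x k))

mulC : Code 2
mulC = cRec cZ (app₂ addC (cP (suc (suc zero))) (cP (suc zero)))

mul-computes : Computes₂ mulC _*_
mul-computes = recursion₂ _*_ (λ _ y x → x + y) (λ _ → eZ)
                 (compose₂ add-computes (projection (suc (suc zero))) (projection (suc zero)))
                 (λ _ _ → refl)

∣-∣≡∸+∸ : ∀ x y → ∣ x - y ∣ ≡ (x ∸ y) + (y ∸ x)
∣-∣≡∸+∸ zero    zero    = refl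
∣-∣≡∸+∸ zero    (suc y) = refl
∣-∣≡∸+∸ (suc x) zero    = sym (+-identityʳ (suc x))
∣-∣≡∸+∸ (suc x) (suc y) = ∣-∣≡∸+∸ x y

distC : Code 2
distC = app₂ addC (app₂ monusC (cP (suc zero)) (cP zero)) (app₂ monusC (cP zero) (cP (suc zero)))

dist-computes : Computes₂ distC ∣_-_∣
dist-computes = computes-ext
  (compose₂ add-computes (compose₂ monus-computes (projection (suc zero)) (projection zero))
                         (compose₂ monus-computes (projection zero) (projection (suc zero))))
  (λ { (x ∷ y ∷ []) → sym (∣-∣≡∸+∸ x y) })

notC : ∀ {n} → Code n → Code n
notC t = app₂ monusC t (const 1)

not-computes : ∀ {n} {t} {B : Vec ℕ n → Bool} →
               Computes t (λ xs → bit (B xs)) → Computes (notC t) (λ xs → bit (not (B xs)))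
not-computes ht = computes-ext (compose₂ monus-computes ht (const-computes 1)) (λ xs → sym (bit-not _))

condC : ∀ {n} → Code n → Code n → Code n → Code n
condC t a b = app₂ addC (app₂ mulC t a) (app₂ mulC (notC t) b)

cond-computes : ∀ {n} {t a b} {B : Vec ℕ n → Bool} {F G : Vec ℕ n → ℕ} →
                Computes t (λ xs → bit (B xs)) → Computes a F → Computes b G →
                Computes (condC t a b) (λ xs → if B xs then F xs else G xs)
cond-computes {B = B} {F} {G} ht ha hb =
  computes-ext (compose₂ add-computes (compose₂ mul-computes ht ha) (compose₂ mul-computes (not-computes ht) hb))
               (λ xs → select (B xs) (F xs) (G xs))
  where
  select : ∀ b x y → bit b * x + bit (not b) * y ≡ (if b then x else y)
  select false x y = +-identityʳ y
  select true  x y = trans (+-identityʳ (x + 0)) (+-identityʳ x)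

count-suc : ∀ (S : Set𝟚) n → count S (suc n) ≡ bit (S n) + count S n
count-suc S n with S n
... | false = refl
... | true  = refl

countC : Code 1 → Code 1
countC t = cRec cZ (app₂ addC (app₁ t (cP zero)) (cP (suc zero)))

count-computes : ∀ {t} {S : Set𝟚} → Computes₁ t (λ x → bit (S x)) → Computes₁ (countC t) (count S)
count-computes {S = S} ht =
  recursion₁ (count S) (λ k y → bit (S k) + y) eZ
    (compose₂ add-computes (compose₁ ht (projection zero)) (projection (suc zero)))
    (count-suc S)

funC : CompPerm → Code 1
funC π = proj₁ (computable π)

fun-computes : (π : CompPerm) → Computes₁ (funC π) (fun π)
fun-computes π (x ∷ []) = proj₂ (computable π) x

searchC : CompPerm → Code 2
searchC π = app₂ distC (app₁ (funC π) (cP zero)) (cP (suc zero))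

inverseC : CompPerm → Code 1
inverseC π = cMin (searchC π)

inverse-computes : (π : CompPerm) → Computes₁ (inverseC π) (inv π)
inverse-computes π (y ∷ []) = eMin (subst (Eval (searchC π) (inv π y ∷ y ∷ [])) found (distance _)) below
  where
  distance : Computes (searchC π) (λ xs → ∣ fun π (lookup xs zero) - lookup xs (suc zero) ∣)
  distance = compose₂ dist-computes (compose₁ (fun-computes π) (projection zero)) (projection (suc zero))
  found : ∣ fun π (inv π y) - y ∣ ≡ 0
  found = trans (cong (∣_- y ∣) (fun-inv π y)) (∣n-n∣≡0 y)
  below : ∀ k → k < inv π y → Σ ℕ (λ v → Eval (searchC π) (k ∷ y ∷ []) (suc v))
  below k k<inv with ∣ fun π k - y ∣ in eq
  ... | zero  = ⊥-elim (<⇒≢ k<inv (trans (sym (inv-fun π k)) (cong (inv π) (∣m-n∣≡0⇒m≡n eq))))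
  ... | suc v = v , subst (Eval (searchC π) (k ∷ y ∷ [])) eq (distance _)

count-step : ∀ (S : Set𝟚) n → count S n ≤ count S (suc n)
count-step S n with S n
... | false = ≤-refl
... | true  = n≤1+n (count S n)

count-mono : ∀ (S : Set𝟚) {x y} → x ≤ y → count S x ≤ count S y
count-mono S {y = zero} z≤n = ≤-refl
count-mono S {x} {suc y} x≤1+y with m≤n⇒m<n∨m≡n x≤1+y
... | inj₁ x<1+y = ≤-trans (count-mono S (s≤s⁻¹ x<1+y)) (count-step S y)
... | inj₂ refl  = ≤-refl

count-≤ : ∀ (S : Set𝟚) n → count S n ≤ n
count-≤ S zero    = z≤n
count-≤ S (suc n) with S n
... | false = m≤n⇒m≤1+n (count-≤ S n)
... | true  = s≤s (count-≤ S n)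

count-strict : ∀ (S : Set𝟚) {x y} → x < y → S x ≡ true → count S x < count S y
count-strict S {x} x<y Sx = ≤-trans (≤-reflexive (sym step)) (count-mono S x<y)
  where
  step : count S (suc x) ≡ suc (count S x)
  step = trans (count-suc S x) (cong (λ b → bit b + count S x) Sx)

count-ext : ∀ (S T : Set𝟚) → (∀ n → S n ≡ T n) → ∀ n → count S n ≡ count T n
count-ext S T S≡T zero    = refl
count-ext S T S≡T (suc n) rewrite S≡T n | count-ext S T S≡T n = refl

count-∁ : ∀ (S : Set𝟚) n → count (∁ S) n + count S n ≡ n
count-∁ S zero    = refl
count-∁ S (suc n) with S n
... | false = cong suc (count-∁ S n)
... | true  = trans (+-suc (count (∁ S) n) (count S n)) (cong suc (count-∁ S n))

rank-injective : ∀ (S : Set𝟚) {x y} → S x ≡ true → S y ≡ true → count S x ≡ count S y → x ≡ y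
rank-injective S {x} {y} Sx Sy eq with <-cmp x y
... | tri< x<y _ _ = ⊥-elim (<⇒≢ (count-strict S x<y Sx) eq)
... | tri≈ _ x≡y _ = x≡y
... | tri> _ _ y<x = ⊥-elim (<⇒≢ (count-strict S y<x Sy) (sym eq))

rank-surjective : ∀ (S : Set𝟚) X j → j < count S X → Σ ℕ (λ x → S x ≡ true × count S x ≡ j)
rank-surjective S zero    j ()
rank-surjective S (suc X) j j<count with j <? count S X
... | yes j<countX = rank-surjective S X j j<countX
... | no  j≮countX with S X in SX
...   | true  = X , SX , ≤-antisym (≮⇒≥ j≮countX) (s≤s⁻¹ j<count)
...   | false = ⊥-elim (j≮countX j<count)

maxUpTo : (ℕ → ℕ) → ℕ → ℕ
maxUpTo h zero    = h zero
maxUpTo h (suc j) = maxUpTo h j ⊔ h (suc j)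

maxUpTo-≥ : ∀ (h : ℕ → ℕ) {i} j → i ≤ j → h i ≤ maxUpTo h j
maxUpTo-≥ h zero    z≤n = ≤-refl
maxUpTo-≥ h {i} (suc j) i≤1+j with m≤n⇒m<n∨m≡n i≤1+j
... | inj₁ i<1+j = ≤-trans (maxUpTo-≥ h j (s≤s⁻¹ i<1+j)) (m≤m⊔n (maxUpTo h j) (h (suc j)))
... | inj₂ refl  = m≤n⊔m (maxUpTo h j) (h (suc j))

-- Pigeonhole: if S contains an injective sequence h, then S has more than j
-- elements below 1 + max (h 0, …, h j).
count-unbounded : ∀ (S : Set𝟚) (h : ℕ → ℕ) → (∀ {a b} → h a ≡ h b → a ≡ b) →
                  (∀ i → S (h i) ≡ true) → ∀ j → j < count S (suc (maxUpTo h j))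
count-unbounded S h h-inj h∈S j = Fin.injective⇒≤ rank-inj
  where
  bound : ∀ (i : Fin (suc j)) → count S (h (toℕ i)) < count S (suc (maxUpTo h j))
  bound i = count-strict S (s≤s (maxUpTo-≥ h j (Fin.toℕ≤pred[n] i))) (h∈S (toℕ i))
  rank : Fin (suc j) → Fin (count S (suc (maxUpTo h j)))
  rank i = fromℕ< (bound i)
  rank-inj : ∀ {i i′} → rank i ≡ rank i′ → i ≡ i′
  rank-inj {i} {i′} eq = Fin.toℕ-injective (h-inj (rank-injective S (h∈S _) (h∈S _) counts))
    where
    counts : count S (h (toℕ i)) ≡ count S (h (toℕ i′))
    counts = trans (sym (Fin.toℕ-fromℕ< (bound i))) (trans (cong toℕ eq) (Fin.toℕ-fromℕ< (bound i′)))

∅ : Set𝟚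
∅ _ = false

count-∅ : ∀ n → count ∅ n ≡ 0
count-∅ zero    = refl
count-∅ (suc n) = count-∅ n

-- Parity and halving, defined by one-step recursion so that they are visibly primitive
-- recursive.
isOdd : ℕ → Bool
isOdd zero    = false
isOdd (suc n) = not (isOdd n)

half : ℕ → ℕ
half zero    = 0
half (suc n) = half n + bit (isOdd n)

data ParityView : ℕ → Set where
  even : ∀ q → ParityView (q * 2)
  odd  : ∀ q → ParityView (suc (q * 2))

parityView : ∀ n → ParityView n
parityView zero = even 0
parityView (suc n) with parityView n
... | even q = odd q
... | odd q  = even (suc q)

isOdd-even : ∀ q → isOdd (q * 2) ≡ false
isOdd-even zero    = refl
isOdd-even (suc q) = cong (λ b → not (not b)) (isOdd-even q)

isOdd-odd : ∀ q → isOdd (suc (q * 2)) ≡ true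
isOdd-odd q = cong not (isOdd-even q)

half-even : ∀ q → half (q * 2) ≡ q
half-even zero    = refl
half-even (suc q) rewrite isOdd-even q | half-even q = trans (cong (_+ 1) (+-identityʳ q)) (+-comm q 1)

half-odd : ∀ q → half (suc (q * 2)) ≡ q
half-odd q rewrite isOdd-even q | half-even q = +-identityʳ q

⊕-even : ∀ (X Y : Set𝟚) q → (X ⊕ Y) (q * 2) ≡ X q
⊕-even X Y zero    = refl
⊕-even X Y (suc q) = ⊕-even (λ k → X (suc k)) (λ k → Y (suc k)) q

⊕-odd : ∀ (X Y : Set𝟚) q → (X ⊕ Y) (suc (q * 2)) ≡ Y q
⊕-odd X Y zero    = refl
⊕-odd X Y (suc q) = ⊕-odd (λ k → X (suc k)) (λ k → Y (suc k)) q

parityC : Code 1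
parityC = cRec cZ (notC (cP (suc zero)))

parity-computes : Computes₁ parityC (λ n → bit (isOdd n))
parity-computes = recursion₁ (λ n → bit (isOdd n)) (λ _ y → 1 ∸ y) eZ
                    (compose₂ monus-computes (projection (suc zero)) (const-computes 1))
                    (λ k → bit-not (isOdd k))

halfC : Code 1
halfC = cRec cZ (app₂ addC (cP (suc zero)) (app₁ parityC (cP zero)))

half-computes : Computes₁ halfC half
half-computes = recursion₁ half (λ k y → y + bit (isOdd k)) eZ
                  (compose₂ add-computes (projection (suc zero)) (compose₁ parity-computes (projection zero)))
                  (λ _ → refl)

count-⊕ : ∀ (X Y : Set𝟚) q → count (X ⊕ Y) (q * 2) ≡ count X q + count Y q
count-⊕ X Y zero    = refl
count-⊕ X Y (suc q) = begin
  count (X ⊕ Y) (suc (suc (q * 2)))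
    ≡⟨ trans (count-suc (X ⊕ Y) (suc (q * 2))) (cong (bit ((X ⊕ Y) (suc (q * 2))) +_) (count-suc (X ⊕ Y) (q * 2))) ⟩
  bit ((X ⊕ Y) (suc (q * 2))) + (bit ((X ⊕ Y) (q * 2)) + count (X ⊕ Y) (q * 2))
    ≡⟨ cong₂ (λ y x → bit y + (bit x + count (X ⊕ Y) (q * 2))) (⊕-odd X Y q) (⊕-even X Y q) ⟩
  bit (Y q) + (bit (X q) + count (X ⊕ Y) (q * 2))
    ≡⟨ cong (λ c → bit (Y q) + (bit (X q) + c)) (count-⊕ X Y q) ⟩
  bit (Y q) + (bit (X q) + (count X q + count Y q))
    ≡⟨ regroup (bit (Y q)) (bit (X q)) (count X q) (count Y q) ⟩
  (bit (X q) + count X q) + (bit (Y q) + count Y q)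
    ≡⟨ sym (cong₂ _+_ (count-suc X q) (count-suc Y q)) ⟩
  count X (suc q) + count Y (suc q) ∎
  where
  open ≡-Reasoning
  regroup : ∀ a b c d → a + (b + (c + d)) ≡ (b + c) + (a + d)
  regroup = solve-∀

record Enumeration (D : Set𝟚) : Set where
  field
    enum            : ℕ → ℕ
    index           : ℕ → ℕ
    enum-in         : ∀ n → D (enum n) ≡ true
    index-enum      : ∀ n → index (enum n) ≡ n
    enum-index      : ∀ x → D x ≡ true → enum (index x) ≡ x
    memberC         : Code 1
    member-computes : Computes₁ memberC (λ x → bit (D x))
    enumC           : Code 1
    enum-computes   : Computes₁ enumC enum

Odds Evens : Set𝟚
Odds  = isOdd
Evens = ∁ Odds

doubleC : Code 1
doubleC = app₂ mulC (cP zero) (const 2)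

double-computes : Computes₁ doubleC (λ q → q * 2)
double-computes = compose₂ mul-computes (projection zero) (const-computes 2)

evens : Enumeration Evens
evens = record
  { enum = λ q → q * 2 ; index = half
  ; enum-in = λ q → cong not (isOdd-even q) ; index-enum = half-even ; enum-index = even-index
  ; memberC = notC parityC ; member-computes = not-computes parity-computes
  ; enumC = doubleC ; enum-computes = double-computes }
  where
  even-index : ∀ x → Evens x ≡ true → half x * 2 ≡ x
  even-index x x-even with parityView x
  ... | even q = cong (_* 2) (half-even q)
  ... | odd q  with () ← trans (sym (cong (λ b → not (not b)) (isOdd-even q))) x-even

odds : Enumeration Odds
odds = record
  { enum = λ q → suc (q * 2) ; index = half
  ; enum-in = isOdd-odd ; index-enum = half-odd ; enum-index = odd-index
  ; memberC = parityC ; member-computes = parity-computes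
  ; enumC = app₁ cS doubleC ; enum-computes = compose₁ successor double-computes }
  where
  odd-index : ∀ x → Odds x ≡ true → suc (half x * 2) ≡ x
  odd-index x x-odd with parityView x
  ... | odd q  = cong (λ h → suc (h * 2)) (half-odd q)
  ... | even q with () ← trans (sym (isOdd-even q)) x-odd

-- Relativising a computable permutation π to an enumerated set D: σ n is the rank of
-- π (enum n) inside π(D).  σ is again a computable permutation, and it transports
-- X ⊆ ω along D: the element of π(D) of rank r belongs to σ(X) iff its D-index lies in X.
module Relativise (π : CompPerm) {D : Set𝟚} (E : Enumeration D) where
  open Enumeration E
  open ≡-Reasoning

  πD : Set𝟚
  πD = image π D

  πenum : ℕ → ℕ
  πenum n = fun π (enum n)

  πenum-in : ∀ n → πD (πenum n) ≡ true
  πenum-in n = trans (cong D (inv-fun π (enum n))) (enum-in n)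

  πenum-injective : ∀ {a b} → πenum a ≡ πenum b → a ≡ b
  πenum-injective {a} {b} eq = begin
    a                         ≡⟨ sym (index-enum a) ⟩
    index (enum a)            ≡⟨ cong index (sym (inv-fun π (enum a))) ⟩
    index (inv π (πenum a))   ≡⟨ cong (λ y → index (inv π y)) eq ⟩
    index (inv π (πenum b))   ≡⟨ cong index (inv-fun π (enum b)) ⟩
    index (enum b)            ≡⟨ index-enum b ⟩
    b                         ∎

  πenum-index : ∀ y → πD y ≡ true → πenum (index (inv π y)) ≡ y
  πenum-index y y∈πD = trans (cong (fun π) (enum-index (inv π y) y∈πD)) (fun-inv π y)

  rank : ℕ → ℕ
  rank n = count πD (πenum n)

  rank-inj : ∀ {a b} → rank a ≡ rank b → a ≡ b
  rank-inj eq = πenum-injective (rank-injective πD (πenum-in _) (πenum-in _) eq)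

  -- An element of π(D) of rank j exists because π(D) is infinite.
  ofRank : ∀ j → Σ ℕ (λ y → πD y ≡ true × count πD y ≡ j)
  ofRank j = rank-surjective πD _ j (count-unbounded πD πenum πenum-injective πenum-in j)

  unrank : ℕ → ℕ
  unrank j = index (inv π (proj₁ (ofRank j)))

  rank-unrank : ∀ j → rank (unrank j) ≡ j
  rank-unrank j with ofRank j
  ... | y , y∈πD , rank-y = trans (cong (count πD) (πenum-index y y∈πD)) rank-y

  unrank-rank : ∀ n → unrank (rank n) ≡ n
  unrank-rank n = rank-inj (rank-unrank (rank n))

  rank-computes : Computes₁ (app₁ (countC (app₁ memberC (inverseC π))) (app₁ (funC π) enumC)) rank
  rank-computes = compose₁ (count-computes (compose₁ member-computes (inverse-computes π)))
                           (compose₁ (fun-computes π) enum-computes)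

  σ : CompPerm
  σ = record { fun = rank ; inv = unrank ; inv-fun = unrank-rank ; fun-inv = rank-unrank
             ; computable = toComputable rank-computes }

  image-σ : ∀ (X : Set𝟚) y → πD y ≡ true → image σ X (count πD y) ≡ X (index (inv π y))
  image-σ X y y∈πD = cong X (begin
    unrank (count πD y)                        ≡⟨ cong (λ z → unrank (count πD z)) (sym (πenum-index y y∈πD)) ⟩
    unrank (rank (index (inv π y)))            ≡⟨ unrank-rank (index (inv π y)) ⟩
    index (inv π y)                            ∎)

  count-σ-in : ∀ (X : Set𝟚) y → πD y ≡ true →
               count (image σ X) (count πD (suc y)) ≡ bit (X (index (inv π y))) + count (image σ X) (count πD y)
  count-σ-in X y y∈πD = begin
    count (image σ X) (count πD (suc y))                      ≡⟨ cong (count (image σ X)) (count-suc πD y) ⟩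
    count (image σ X) (bit (πD y) + count πD y)               ≡⟨ cong (λ b → count (image σ X) (bit b + count πD y)) y∈πD ⟩
    count (image σ X) (suc (count πD y))                      ≡⟨ count-suc (image σ X) (count πD y) ⟩
    bit (image σ X (count πD y)) + count (image σ X) (count πD y)  ≡⟨ cong (λ b → bit b + count (image σ X) (count πD y)) (image-σ X y y∈πD) ⟩
    bit (X (index (inv π y))) + count (image σ X) (count πD y)     ∎

  count-σ-out : ∀ (X : Set𝟚) y → πD y ≡ false →
                count (image σ X) (count πD (suc y)) ≡ count (image σ X) (count πD y)
  count-σ-out X y y∉πD = cong (count (image σ X)) (trans (count-suc πD y) (cong (λ b → bit b + count πD y) y∉πD))

module Split (π : CompPerm) where
  open ≡-Reasoning
  module σ₀ = Relativise π evens
  module σ₁ = Relativise π odds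

  count-image-⊕ : ∀ (X Y : Set𝟚) N → count (image π (X ⊕ Y)) N ≡
            count (image σ₀.σ X) (count σ₀.πD N) + count (image σ₁.σ Y) (count σ₁.πD N)
  count-image-⊕ X Y zero    = refl
  count-image-⊕ X Y (suc N) = begin
    count (image π (X ⊕ Y)) (suc N)                ≡⟨ count-suc (image π (X ⊕ Y)) N ⟩
    bit ((X ⊕ Y) (inv π N)) + count (image π (X ⊕ Y)) N  ≡⟨ cong (bit ((X ⊕ Y) (inv π N)) +_) (count-image-⊕ X Y N) ⟩
    bit ((X ⊕ Y) (inv π N)) + (a N + b N)           ≡⟨ step (inv π N) refl (parityView (inv π N)) ⟩
    a (suc N) + b (suc N)                           ∎
    where
    a b : ℕ → ℕ
    a n = count (image σ₀.σ X) (count σ₀.πD n)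
    b n = count (image σ₁.σ Y) (count σ₁.πD n)
    step : ∀ m → inv π N ≡ m → ParityView m → bit ((X ⊕ Y) m) + (a N + b N) ≡ a (suc N) + b (suc N)
    step .(q * 2) eq (even q) = begin
      bit ((X ⊕ Y) (q * 2)) + (a N + b N)    ≡⟨ cong (λ z → bit z + (a N + b N)) (⊕-even X Y q) ⟩
      bit (X q) + (a N + b N)                ≡⟨ sym (+-assoc (bit (X q)) (a N) (b N)) ⟩
      bit (X q) + a N + b N                  ≡⟨ cong (λ i → bit (X i) + a N + b N) (sym index≡q) ⟩
      bit (X (half (inv π N))) + a N + b N   ≡⟨ sym (cong₂ _+_ (σ₀.count-σ-in X N in₀) (σ₁.count-σ-out Y N out₁)) ⟩
      a (suc N) + b (suc N)                  ∎
      where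
      out₁ : isOdd (inv π N) ≡ false
      out₁ = trans (cong isOdd eq) (isOdd-even q)
      in₀ : not (isOdd (inv π N)) ≡ true
      in₀ = cong not out₁
      index≡q : half (inv π N) ≡ q
      index≡q = trans (cong half eq) (half-even q)
    step .(suc (q * 2)) eq (odd q) = begin
      bit ((X ⊕ Y) (suc (q * 2))) + (a N + b N)  ≡⟨ cong (λ z → bit z + (a N + b N)) (⊕-odd X Y q) ⟩
      bit (Y q) + (a N + b N)                    ≡⟨ x∙yz≈y∙xz (bit (Y q)) (a N) (b N) ⟩
      a N + (bit (Y q) + b N)                    ≡⟨ cong (λ i → a N + (bit (Y i) + b N)) (sym index≡q) ⟩
      a N + (bit (Y (half (inv π N))) + b N)     ≡⟨ sym (cong₂ _+_ (σ₀.count-σ-out X N out₀) (σ₁.count-σ-in Y N in₁)) ⟩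
      a (suc N) + b (suc N)                      ∎
      where
      in₁ : isOdd (inv π N) ≡ true
      in₁ = trans (cong isOdd eq) (isOdd-odd q)
      out₀ : not (isOdd (inv π N)) ≡ false
      out₀ = cong not in₁
      index≡q : half (inv π N) ≡ q
      index≡q = trans (cong half eq) (half-odd q)

-- deviation S n = ∣ 2·|S ∩ n| - n ∣, so that ρ_n(S) = ½ ± deviation S n / 2n.
deviation : Set𝟚 → ℕ → ℕ
deviation S n = ∣ count S n * 2 - n ∣

∣⊖∣≡∣-∣ : ∀ m n → ℤ.∣ m ℤ.⊖ n ∣ ≡ ∣ m - n ∣
∣⊖∣≡∣-∣ m n with m ≤? n
... | yes m≤n = trans (ℤ.∣⊖∣-≤ m≤n) (sym (m≤n⇒∣m-n∣≡n∸m m≤n))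
... | no  m≰n = begin
  ℤ.∣ m ℤ.⊖ n ∣  ≡⟨ ℤ.∣m⊖n∣≡∣n⊖m∣ m n ⟩
  ℤ.∣ n ℤ.⊖ m ∣  ≡⟨ ℤ.∣⊖∣-≤ n≤m ⟩
  m ∸ n          ≡⟨ sym (m≤n⇒∣m-n∣≡n∸m n≤m) ⟩
  ∣ n - m ∣      ≡⟨ ∣-∣-comm n m ⟩
  ∣ m - n ∣      ∎
  where
  open ≡-Reasoning
  n≤m : n ≤ m
  n≤m = ≰⇒≥ m≰n

+◃<+⇒< : ∀ {a b} → Sign.+ ℤ.◃ a ℤ.< ℤ.+ b → a < b
+◃<+⇒< {a} {b} p = ℤ.+◃-cancel-< (subst (Sign.+ ℤ.◃ a ℤ.<_) (sym (ℤ.+◃n≡+n b)) p)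

<⇒+◃<+ : ∀ {a b} → a < b → Sign.+ ℤ.◃ a ℤ.< ℤ.+ b
<⇒+◃<+ {a} {b} p = subst (Sign.+ ℤ.◃ a ℤ.<_) (ℤ.+◃n≡+n b) (ℤ.+◃-mono-< p)

numerator-ρ-½ : ∀ c n → ℤ.∣ (Sign.+ ℤ.◃ c) ℤ.+ ℤ.-[1+ n + 0 ] ∣ ≡ ∣ c - suc n ∣
numerator-ρ-½ c n rewrite ℤ.+◃n≡+n c | +-identityʳ n = ∣⊖∣≡∣-∣ c (suc n)

near-½⇒ : ∀ (S : Set𝟚) n k → ℚ.∣ ρ₁₊ S n ℚ.- ½ ∣ <ℚ inv₁₊ k → deviation S (suc n) * suc k < suc n * 2
near-½⇒ S n k (*<* p) with +◃<+⇒< p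
... | q rewrite numerator-ρ-½ (count S (suc n) * 2) n | +-identityʳ (n * 2) = q

⇒near-½ : ∀ (S : Set𝟚) n k → deviation S (suc n) * suc k < suc n * 2 → ℚ.∣ ρ₁₊ S n ℚ.- ½ ∣ <ℚ inv₁₊ k
⇒near-½ S n k q = *<* (<⇒+◃<+ (subst₂ _<_ (cong (_* suc k) (sym (numerator-ρ-½ (count S (suc n) * 2) n)))
                                        (cong (2 +_) (sym (+-identityʳ (n * 2)))) q))

near⇒ : ∀ a b n k → ℚ.∣ ℚ.mkℚᵘ (ℤ.+ a) n ℚ.- ℚ.mkℚᵘ (ℤ.+ b) n ∣ <ℚ inv₁₊ k → ∣ a - b ∣ * suc k < suc n
near⇒ a b n k (*<* p) = *-cancelʳ-< (suc n) (∣ a - b ∣ * suc k) (suc n)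
                          (subst₂ _<_ numerator (+-identityʳ (suc n * suc n)) (+◃<+⇒< p))
  where
  open ≡-Reasoning
  numerator : ℤ.∣ ℤ.+ a ℤ.* ℤ.+ suc n ℤ.+ ℤ.- ℤ.+ b ℤ.* ℤ.+ suc n ∣ * suc k ≡ ∣ a - b ∣ * suc k * suc n
  numerator = begin
    ℤ.∣ ℤ.+ a ℤ.* ℤ.+ suc n ℤ.+ ℤ.- ℤ.+ b ℤ.* ℤ.+ suc n ∣ * suc k
      ≡⟨ cong (λ z → ℤ.∣ z ∣ * suc k) (sym (ℤ.*-distribʳ-+ (ℤ.+ suc n) (ℤ.+ a) (ℤ.- ℤ.+ b))) ⟩
    ℤ.∣ (ℤ.+ a ℤ.- ℤ.+ b) ℤ.* ℤ.+ suc n ∣ * suc k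
      ≡⟨ cong (_* suc k) (ℤ.∣i*j∣≡∣i∣*∣j∣ (ℤ.+ a ℤ.- ℤ.+ b) (ℤ.+ suc n)) ⟩
    ℤ.∣ ℤ.+ a ℤ.- ℤ.+ b ∣ * suc n * suc k
      ≡⟨ cong (λ z → ℤ.∣ z ∣ * suc n * suc k) (ℤ.m-n≡m⊖n a b) ⟩
    ℤ.∣ a ℤ.⊖ b ∣ * suc n * suc k
      ≡⟨ cong (λ z → z * suc n * suc k) (∣⊖∣≡∣-∣ a b) ⟩
    ∣ a - b ∣ * suc n * suc k
      ≡⟨ xy∙z≈xz∙y ∣ a - b ∣ (suc n) (suc k) ⟩
    ∣ a - b ∣ * suc k * suc n ∎

∣2x-n∣≡∣x-y∣ : ∀ x y n → x + y ≡ n → ∣ x * 2 - n ∣ ≡ ∣ x - y ∣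
∣2x-n∣≡∣x-y∣ x y n x+y≡n = begin
  ∣ x * 2 - n ∣            ≡⟨ cong₂ ∣_-_∣ (trans (*-comm x 2) (cong (x +_) (+-identityʳ x))) (sym x+y≡n) ⟩
  ∣ x + x - x + y ∣        ≡⟨ ∣m+n-m+o∣≡∣n-o∣ x x y ⟩
  ∣ x - y ∣                ∎
  where open ≡-Reasoning

∣+-+∣≤ : ∀ x y u v → ∣ x + y - u + v ∣ ≤ ∣ x - u ∣ + ∣ y - v ∣
∣+-+∣≤ x y u v = begin
  ∣ x + y - u + v ∣                      ≤⟨ ∣-∣-triangle (x + y) (u + y) (u + v) ⟩
  ∣ x + y - u + y ∣ + ∣ u + y - u + v ∣  ≡⟨ cong₂ _+_ shift (∣m+n-m+o∣≡∣n-o∣ u y v) ⟩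
  ∣ x - u ∣ + ∣ y - v ∣                  ∎
  where
  open ≤-Reasoning
  shift : ∣ x + y - u + y ∣ ≡ ∣ x - u ∣
  shift = trans (cong₂ ∣_-_∣ (+-comm x y) (+-comm u y)) (∣m+n-m+o∣≡∣n-o∣ y x u)

deviation-∁ : ∀ (S : Set𝟚) n → deviation (∁ S) n ≡ deviation S n
deviation-∁ S n = begin
  deviation (∁ S) n   ≡⟨ ∣2x-n∣≡∣x-y∣ d c n (count-∁ S n) ⟩
  ∣ d - c ∣           ≡⟨ ∣-∣-comm d c ⟩
  ∣ c - d ∣           ≡⟨ sym (∣2x-n∣≡∣x-y∣ c d n (trans (+-comm c d) (count-∁ S n))) ⟩
  deviation S n       ∎
  where
  open ≡-Reasoning
  c d : ℕ
  c = count S n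
  d = count (∁ S) n

deviation-≤ : ∀ (S : Set𝟚) n → deviation S n ≤ n
deviation-≤ S n = begin
  deviation S n   ≡⟨ ∣2x-n∣≡∣x-y∣ c d n (trans (+-comm c d) (count-∁ S n)) ⟩
  ∣ c - d ∣       ≤⟨ ∣m-n∣≤m⊔n c d ⟩
  c ⊔ d           ≤⟨ m⊔n≤m+n c d ⟩
  c + d           ≡⟨ trans (+-comm c d) (count-∁ S n) ⟩
  n               ∎
  where
  open ≤-Reasoning
  c d : ℕ
  c = count S n
  d = count (∁ S) n

deviation-split : ∀ (Z X Y : Set𝟚) N c₀ c₁ → c₀ + c₁ ≡ N → count Z N ≡ count X c₀ + count Y c₁ →
                  deviation Z N ≤ deviation X c₀ + deviation Y c₁
deviation-split Z X Y N c₀ c₁ c₀+c₁≡N countZ = begin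
  ∣ count Z N * 2 - N ∣                   ≡⟨ cong₂ ∣_-_∣ (trans (cong (_* 2) countZ) (*-distribʳ-+ 2 a b)) (sym c₀+c₁≡N) ⟩
  ∣ a * 2 + b * 2 - c₀ + c₁ ∣             ≤⟨ ∣+-+∣≤ (a * 2) (b * 2) c₀ c₁ ⟩
  deviation X c₀ + deviation Y c₁         ∎
  where
  open ≤-Reasoning
  a b : ℕ
  a = count X c₀
  b = count Y c₁

-- Density ½ of S bounds the deviation of every initial segment c ≤ T of S by T / (k+1),
-- as soon as T exceeds a threshold N₀ · (k+1): long segments are close to ½ by density
-- (tolerance 1/(2(k+1))), short ones have deviation at most their length c ≤ N₀.
small-deviations : ∀ (S : Set𝟚) k → HasDensity S ½ →
                   Σ ℕ (λ N₀ → ∀ c T → c ≤ T → N₀ * suc k < T → deviation S c * suc k < T)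
small-deviations S k density = N₀ , small
  where
  N₀ : ℕ
  N₀ = proj₁ (density (suc (k * 2)))
  near : ∀ n → N₀ ≤ n → deviation S (suc n) * (suc k * 2) < suc n * 2
  near n N₀≤n = near-½⇒ S n (suc (k * 2)) (proj₂ (density (suc (k * 2))) n N₀≤n)
  small : ∀ c T → c ≤ T → N₀ * suc k < T → deviation S c * suc k < T
  small zero    T c≤T N₀K<T = ≤-<-trans z≤n N₀K<T
  small (suc n) T c≤T N₀K<T with N₀ ≤? n
  ... | yes N₀≤n = <-≤-trans (*-cancelʳ-< 2 _ _ (subst (_< suc n * 2) (sym (*-assoc (deviation S (suc n)) (suc k) 2)) (near n N₀≤n))) c≤T
  ... | no  N₀≰n = ≤-<-trans (*-monoˡ-≤ (suc k) (≤-trans (deviation-≤ S (suc n)) (≰⇒> N₀≰n))) N₀K<T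

-- Relativising π to the
-- evens and the odds gives computable permutations σ₀, σ₁, and π(A ⊕ Ā) up to N splits
-- into σ₀(A) up to c₀ and σ₁(Ā) = ∁ σ₁(A) up to c₁, where c₀ + c₁ = N.  Both parts
-- have density ½ by hypothesis, so their deviations are eventually small.
⊕∁-intrinsic-½ : (A : Set𝟚) → HasIntrinsicDensity A ½ → HasIntrinsicDensity (A ⊕ ∁ A) ½
⊕∁-intrinsic-½ A hyp π k = (N₀ + N₁) * suc k , λ n N≤n → ⇒near-½ (image π (A ⊕ ∁ A)) n k (bound n N≤n)
  where
  open Split π
  N₀ N₁ : ℕ
  N₀ = proj₁ (small-deviations (image σ₀.σ A) k (hyp σ₀.σ))
  N₁ = proj₁ (small-deviations (image σ₁.σ A) k (hyp σ₁.σ))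
  small₀ : ∀ c T → c ≤ T → N₀ * suc k < T → deviation (image σ₀.σ A) c * suc k < T
  small₀ = proj₂ (small-deviations (image σ₀.σ A) k (hyp σ₀.σ))
  small₁ : ∀ c T → c ≤ T → N₁ * suc k < T → deviation (image σ₁.σ A) c * suc k < T
  small₁ = proj₂ (small-deviations (image σ₁.σ A) k (hyp σ₁.σ))
  bound : ∀ n → (N₀ + N₁) * suc k ≤ n → deviation (image π (A ⊕ ∁ A)) (suc n) * suc k < suc n * 2
  bound n N≤n = begin-strict
    deviation (image π (A ⊕ ∁ A)) (suc n) * suc k                  ≤⟨ *-monoˡ-≤ (suc k) split ⟩
    (deviation (image σ₀.σ A) c₀ + deviation (image σ₁.σ (∁ A)) c₁) * suc k
                                                                   ≡⟨ cong (λ d → (deviation (image σ₀.σ A) c₀ + d) * suc k) (deviation-∁ (image σ₁.σ A) c₁) ⟩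
    (deviation (image σ₀.σ A) c₀ + deviation (image σ₁.σ A) c₁) * suc k
                                                                   ≡⟨ *-distribʳ-+ (suc k) (deviation (image σ₀.σ A) c₀) _ ⟩
    deviation (image σ₀.σ A) c₀ * suc k + deviation (image σ₁.σ A) c₁ * suc k
                                                                   <⟨ +-mono-< (small₀ c₀ (suc n) (count-≤ _ _) N₀K<) (small₁ c₁ (suc n) (count-≤ _ _) N₁K<) ⟩
    suc n + suc n                                                  ≡⟨ sym (trans (*-comm (suc n) 2) (cong (suc n +_) (+-identityʳ (suc n)))) ⟩
    suc n * 2                                                      ∎
    where
    open ≤-Reasoning
    c₀ c₁ : ℕ
    c₀ = count σ₀.πD (suc n)
    c₁ = count σ₁.πD (suc n)
    split : deviation (image π (A ⊕ ∁ A)) (suc n) ≤ deviation (image σ₀.σ A) c₀ + deviation (image σ₁.σ (∁ A)) c₁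
    split = deviation-split _ _ _ (suc n) c₀ c₁ (count-∁ σ₁.πD (suc n)) (count-image-⊕ A (∁ A) (suc n))
    N₀K< : N₀ * suc k < suc n
    N₀K< = s≤s (≤-trans (*-monoˡ-≤ (suc k) (m≤m+n N₀ N₁)) N≤n)
    N₁K< : N₁ * suc k < suc n
    N₁K< = s≤s (≤-trans (*-monoˡ-≤ (suc k) (m≤n+m N₁ N₀)) N≤n)

-- τ moves the odd numbers onto the multiples of 3 and the even numbers, in order, onto
-- the remaining numbers:  τ (2q+1) = 3q,  τ (4m) = 3m+1,  τ (4m+2) = 3m+2.
τ : ℕ → ℕ
τ n = if isOdd n then half n * 3 else suc (half (half n) * 3 + bit (isOdd (half n)))

τ-odd : ∀ q → τ (suc (q * 2)) ≡ q * 3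
τ-odd q rewrite isOdd-odd q | half-odd q = refl

τ-even-even : ∀ m → τ (m * 2 * 2) ≡ suc (m * 3)
τ-even-even m rewrite isOdd-even (m * 2) | half-even (m * 2) | half-even m | isOdd-even m =
  cong suc (+-identityʳ (m * 3))

τ-even-odd : ∀ m → τ (suc (m * 2) * 2) ≡ suc (suc (m * 3))
τ-even-odd m rewrite isOdd-even (suc (m * 2)) | half-even (suc (m * 2)) | half-odd m | isOdd-odd m =
  cong suc (+-comm (m * 3) 1)

τC : Code 1
τC = condC parityC (app₂ mulC halfC (const 3))
       (app₁ cS (app₂ addC (app₂ mulC (app₁ halfC halfC) (const 3)) (app₁ parityC halfC)))

τ-computes : Computes₁ τC τ
τ-computes = cond-computes {B = λ xs → isOdd (lookup xs zero)} parity-computes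
  (compose₂ mul-computes half-computes (const-computes 3))
  (compose₁ successor (compose₂ add-computes (compose₂ mul-computes (compose₁ half-computes half-computes) (const-computes 3))
                                             (compose₁ parity-computes half-computes)))

data Mod3View : ℕ → Set where
  rem0 : ∀ m → Mod3View (m * 3)
  rem1 : ∀ m → Mod3View (suc (m * 3))
  rem2 : ∀ m → Mod3View (suc (suc (m * 3)))

mod3-step : ∀ {n} → Mod3View n → Mod3View (suc n)
mod3-step (rem0 m) = rem1 m
mod3-step (rem1 m) = rem2 m
mod3-step (rem2 m) = rem0 (suc m)

mod3View : ∀ n → Mod3View n
mod3View zero    = rem0 0
mod3View (suc n) = mod3-step (mod3View n)

mod3View-rem0 : ∀ m → mod3View (m * 3) ≡ rem0 m
mod3View-rem0 zero    = refl
mod3View-rem0 (suc m) = cong (λ v → mod3-step (mod3-step (mod3-step v))) (mod3View-rem0 m)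

τ⁻¹-view : ∀ {n} → Mod3View n → ℕ
τ⁻¹-view (rem0 m) = suc (m * 2)
τ⁻¹-view (rem1 m) = m * 2 * 2
τ⁻¹-view (rem2 m) = suc (m * 2) * 2

τ⁻¹ : ℕ → ℕ
τ⁻¹ n = τ⁻¹-view (mod3View n)

τ⁻¹-rem0 : ∀ m → τ⁻¹ (m * 3) ≡ suc (m * 2)
τ⁻¹-rem0 m = cong τ⁻¹-view (mod3View-rem0 m)

τ⁻¹-rem1 : ∀ m → τ⁻¹ (suc (m * 3)) ≡ m * 2 * 2
τ⁻¹-rem1 m = cong (λ v → τ⁻¹-view (mod3-step v)) (mod3View-rem0 m)

τ⁻¹-rem2 : ∀ m → τ⁻¹ (suc (suc (m * 3))) ≡ suc (m * 2) * 2
τ⁻¹-rem2 m = cong (λ v → τ⁻¹-view (mod3-step (mod3-step v))) (mod3View-rem0 m)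

τ-τ⁻¹-view : ∀ {n} (v : Mod3View n) → τ (τ⁻¹-view v) ≡ n
τ-τ⁻¹-view (rem0 m) = τ-odd m
τ-τ⁻¹-view (rem1 m) = τ-even-even m
τ-τ⁻¹-view (rem2 m) = τ-even-odd m

τ⁻¹-τ : ∀ n → τ⁻¹ (τ n) ≡ n
τ⁻¹-τ n with parityView n
... | odd q = trans (cong τ⁻¹ (τ-odd q)) (τ⁻¹-rem0 q)
... | even q with parityView q
...   | even m = trans (cong τ⁻¹ (τ-even-even m)) (τ⁻¹-rem1 m)
...   | odd m  = trans (cong τ⁻¹ (τ-even-odd m)) (τ⁻¹-rem2 m)

τ-perm : CompPerm
τ-perm = record { fun = τ ; inv = τ⁻¹ ; inv-fun = τ⁻¹-τ ; fun-inv = λ n → τ-τ⁻¹-view (mod3View n)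
                ; computable = toComputable τ-computes }

-- In τ(X ⊕ Y), each block {3m, 3m+1, 3m+2} holds Y m, X (2m), X (2m+1); so X is read
-- twice as fast as Y.
count-τ-⊕ : ∀ (X Y : Set𝟚) m → count (image τ-perm (X ⊕ Y)) (m * 3) ≡ count X (m * 2) + count Y m
count-τ-⊕ X Y zero    = refl
count-τ-⊕ X Y (suc m) = begin
  count T (suc (suc (suc (m * 3))))
    ≡⟨ trans (count-suc T (suc (suc (m * 3)))) (cong (bit (T (suc (suc (m * 3)))) +_)
        (trans (count-suc T (suc (m * 3))) (cong (bit (T (suc (m * 3))) +_) (count-suc T (m * 3))))) ⟩
  bit (T (suc (suc (m * 3)))) + (bit (T (suc (m * 3))) + (bit (T (m * 3)) + count T (m * 3)))
    ≡⟨ cong₂ (λ a b → bit a + (bit b + (bit (T (m * 3)) + count T (m * 3)))) at2 at1 ⟩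
  bit (X (suc (m * 2))) + (bit (X (m * 2)) + (bit (T (m * 3)) + count T (m * 3)))
    ≡⟨ cong₂ (λ c r → bit (X (suc (m * 2))) + (bit (X (m * 2)) + (bit c + r))) at0 (count-τ-⊕ X Y m) ⟩
  bit (X (suc (m * 2))) + (bit (X (m * 2)) + (bit (Y m) + (count X (m * 2) + count Y m)))
    ≡⟨ regroup (bit (X (suc (m * 2)))) (bit (X (m * 2))) (bit (Y m)) (count X (m * 2)) (count Y m) ⟩
  (bit (X (suc (m * 2))) + (bit (X (m * 2)) + count X (m * 2))) + (bit (Y m) + count Y m)
    ≡⟨ sym (cong₂ _+_ (trans (count-suc X (suc (m * 2))) (cong (bit (X (suc (m * 2))) +_) (count-suc X (m * 2))))
                      (count-suc Y m)) ⟩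
  count X (suc m * 2) + count Y (suc m) ∎
  where
  open ≡-Reasoning
  T : Set𝟚
  T = image τ-perm (X ⊕ Y)
  at0 : T (m * 3) ≡ Y m
  at0 = trans (cong (X ⊕ Y) (τ⁻¹-rem0 m)) (⊕-odd X Y m)
  at1 : T (suc (m * 3)) ≡ X (m * 2)
  at1 = trans (cong (X ⊕ Y) (τ⁻¹-rem1 m)) (⊕-even X Y (m * 2))
  at2 : T (suc (suc (m * 3))) ≡ X (suc (m * 2))
  at2 = trans (cong (X ⊕ Y) (τ⁻¹-rem2 m)) (⊕-even X Y (suc (m * 2)))
  regroup : ∀ a b c d e → a + (b + (c + (d + e))) ≡ (a + (b + d)) + (c + e)
  regroup = solve-∀

count-⊕∁ : ∀ (A : Set𝟚) q → count (A ⊕ ∁ A) (q * 2) ≡ q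
count-⊕∁ A q = trans (count-⊕ A (∁ A) q) (trans (+-comm (count A q) _) (count-∁ A q))

-- A ▷ (A ⊕ Ā) is A placed on the even numbers: the element of A ⊕ Ā of index q is 2q or
-- 2q + 1 according as q ∈ A or not, and it is selected iff q ∈ A.
▷-shape : ∀ (A : Set𝟚) n → (A ▷ (A ⊕ ∁ A)) n ≡ (A ⊕ ∅) n
▷-shape A n with parityView n
... | even q = begin
  (A ⊕ ∁ A) (q * 2) ∧ A (count (A ⊕ ∁ A) (q * 2))  ≡⟨ cong₂ _∧_ (⊕-even A (∁ A) q) (cong A (count-⊕∁ A q)) ⟩
  A q ∧ A q                                        ≡⟨ ∧-idem (A q) ⟩
  A q                                              ≡⟨ sym (⊕-even A ∅ q) ⟩
  (A ⊕ ∅) (q * 2)                                  ∎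
  where open ≡-Reasoning
... | odd q = begin
  (A ⊕ ∁ A) (suc (q * 2)) ∧ A (count (A ⊕ ∁ A) (suc (q * 2)))
    ≡⟨ cong₂ _∧_ (⊕-odd A (∁ A) q) (cong A (count-suc (A ⊕ ∁ A) (q * 2))) ⟩
  not (A q) ∧ A (bit ((A ⊕ ∁ A) (q * 2)) + count (A ⊕ ∁ A) (q * 2))
    ≡⟨ cong₂ (λ b i → not (A q) ∧ A (bit b + i)) (⊕-even A (∁ A) q) (count-⊕∁ A q) ⟩
  not (A q) ∧ A (bit (A q) + q)
    ≡⟨ unselected (A q) refl ⟩
  false
    ≡⟨ sym (⊕-odd A ∅ q) ⟩
  (A ⊕ ∅) (suc (q * 2)) ∎
  where
  open ≡-Reasoning
  unselected : ∀ b → A q ≡ b → not b ∧ A (bit b + q) ≡ false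
  unselected true  _   = refl
  unselected false A-q = A-q

count-▷ : ∀ (A : Set𝟚) q → count (A ▷ (A ⊕ ∁ A)) (q * 2) ≡ count A q
count-▷ A q = begin
  count (A ▷ (A ⊕ ∁ A)) (q * 2)  ≡⟨ count-ext _ _ (▷-shape A) (q * 2) ⟩
  count (A ⊕ ∅) (q * 2)          ≡⟨ count-⊕ A ∅ q ⟩
  count A q + count ∅ q          ≡⟨ cong (count A q +_) (count-∅ q) ⟩
  count A q + 0                  ≡⟨ +-identityʳ (count A q) ⟩
  count A q                      ∎
  where open ≡-Reasoning

count-τ-▷ : ∀ (A : Set𝟚) m → count (image τ-perm (A ▷ (A ⊕ ∁ A))) (m * 3) ≡ count A (m * 2)
count-τ-▷ A m = begin
  count (image τ-perm (A ▷ (A ⊕ ∁ A))) (m * 3)  ≡⟨ count-ext _ _ (λ y → ▷-shape A (τ⁻¹ y)) (m * 3) ⟩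
  count (image τ-perm (A ⊕ ∅)) (m * 3)          ≡⟨ count-τ-⊕ A ∅ m ⟩
  count A (m * 2) + count ∅ m                   ≡⟨ cong (count A (m * 2) +_) (count-∅ m) ⟩
  count A (m * 2) + 0                           ≡⟨ +-identityʳ (count A (m * 2)) ⟩
  count A (m * 2)                               ∎
  where open ≡-Reasoning

idPerm : CompPerm
idPerm = record { fun = λ n → n ; inv = λ n → n ; inv-fun = λ _ → refl ; fun-inv = λ _ → refl
                ; computable = toComputable (projection zero) }

-- If c₆ is within t/8 of 3t and c₈ within t/6 of 4t, then c₆ and c₈ are not within t/8
-- of each other: 2t ≤ ∣8t - 2c₈∣ + ∣2c₈ - 2c₆∣ + ∣2c₆ - 6t∣ < t/3 + t/4 + t/4.
far-apart : ∀ t c₆ c₈ → ∣ c₆ * 2 - t * 6 ∣ * 48 < t * 6 * 2 → ∣ c₈ * 2 - t * 8 ∣ * 48 < t * 8 * 2 →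
            ∣ c₆ - c₈ ∣ * 96 < t * 12 → ⊥
far-apart t c₆ c₈ near₆ near₈ close = <⇒≱ contradiction (*-monoʳ-≤ t (m≤m+n 40 56))
  where
  open ≤-Reasoning
  e₈ e e₆ : ℕ
  e₈ = ∣ t * 8 - c₈ * 2 ∣
  e = ∣ c₈ * 2 - c₆ * 2 ∣
  e₆ = ∣ c₆ * 2 - t * 6 ∣
  near₈′ : e₈ * 48 < t * 8 * 2
  near₈′ = subst (λ z → z * 48 < t * 8 * 2) (∣-∣-comm (c₈ * 2) (t * 8)) near₈
  close′ : e * 48 < t * 12
  close′ = subst (_< t * 12) (begin-equality
    ∣ c₆ - c₈ ∣ * 96       ≡⟨ cong (_* 96) (∣-∣-comm c₆ c₈) ⟩
    ∣ c₈ - c₆ ∣ * 96       ≡⟨ *-assoc ∣ c₈ - c₆ ∣ 2 48 ⟨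
    ∣ c₈ - c₆ ∣ * 2 * 48   ≡⟨ cong (_* 48) (*-distribʳ-∣-∣ 2 c₈ c₆) ⟩
    e * 48                 ∎) close
  contradiction : t * 96 < t * 40
  contradiction = begin-strict
    t * 96                                 ≡⟨ *-assoc t 2 48 ⟨
    t * 2 * 48                             ≡⟨ cong (_* 48) (*-distribˡ-∣-∣ t 8 6) ⟩
    ∣ t * 8 - t * 6 ∣ * 48                 ≤⟨ *-monoˡ-≤ 48 triangle ⟩
    (e₈ + (e + e₆)) * 48                   ≡⟨ trans (*-distribʳ-+ 48 e₈ (e + e₆)) (cong (e₈ * 48 +_) (*-distribʳ-+ 48 e e₆)) ⟩
    e₈ * 48 + (e * 48 + e₆ * 48)           <⟨ +-mono-< near₈′ (+-mono-< close′ near₆) ⟩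
    t * 8 * 2 + (t * 12 + t * 6 * 2)       ≡⟨ sum t ⟩
    t * 40                                 ∎
    where
    triangle : ∣ t * 8 - t * 6 ∣ ≤ e₈ + (e + e₆)
    triangle = ≤-trans (∣-∣-triangle (t * 8) (c₈ * 2) (t * 6)) (+-monoʳ-≤ e₈ (∣-∣-triangle (c₈ * 2) (c₆ * 2) (t * 6)))
    sum : ∀ t → t * 8 * 2 + (t * 12 + t * 6 * 2) ≡ t * 40
    sum = solve-∀

-- For S = A ▷ (A ⊕ Ā) and T = 12t, the identity sees
-- count A (6t) ≈ 3t elements of S below T, while τ sees count A (8t) ≈ 4t; so the
-- densities of S and τ(S) cannot approach a common limit.
▷-no-intrinsic-density : (A : Set𝟚) → HasIntrinsicDensity A ½ → ¬ HasSomeIntrinsicDensity (A ▷ (A ⊕ ∁ A))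
▷-no-intrinsic-density A hyp common = far-apart t (count A (t * 6)) (count A (t * 8)) near₆ near₈ close
  where
  S : Set𝟚
  S = A ▷ (A ⊕ ∁ A)
  -- thresholds for ∣ρ(S) - ρ(τ S)∣ < 1/96 and for ∣ρ(A) - ½∣ < 1/48
  N M t′ t : ℕ
  N = proj₁ (common idPerm τ-perm 95)
  M = proj₁ (hyp idPerm 47)
  t′ = N + M
  t = suc t′
  below : ∀ r k → t′ ≤ r + t′ * suc k
  below r k = ≤-trans (m≤m*n t′ (suc k)) (m≤n+m (t′ * suc k) r)
  near₆ : deviation A (t * 6) * 48 < t * 6 * 2
  near₆ = near-½⇒ A (5 + t′ * 6) 47 (proj₂ (hyp idPerm 47) _ (≤-trans (m≤n+m M N) (below 5 5)))
  near₈ : deviation A (t * 8) * 48 < t * 8 * 2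
  near₈ = near-½⇒ A (7 + t′ * 8) 47 (proj₂ (hyp idPerm 47) _ (≤-trans (m≤n+m M N) (below 7 7)))
  counts-id : count S (t * 12) ≡ count A (t * 6)
  counts-id = trans (cong (count S) (sym (*-assoc t 6 2))) (count-▷ A (t * 6))
  counts-τ : count (image τ-perm S) (t * 12) ≡ count A (t * 8)
  counts-τ = trans (cong (count (image τ-perm S)) (sym (*-assoc t 4 3)))
               (trans (count-τ-▷ A (t * 4)) (cong (count A) (*-assoc t 4 2)))
  close : ∣ count A (t * 6) - count A (t * 8) ∣ * 96 < t * 12
  close = subst (λ d → d * 96 < t * 12) (cong₂ ∣_-_∣ counts-id counts-τ)
            (near⇒ (count S (t * 12)) (count (image τ-perm S) (t * 12)) (11 + t′ * 12) 95 (proj₂ (common idPerm τ-perm 95) _ _ N≤ N≤))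
    where
    N≤ : N ≤ 11 + t′ * 12
    N≤ = ≤-trans (m≤m+n N M) (below 11 11)

proposition3p6 : (A : Set𝟚) → HasIntrinsicDensity A ½ →
    HasIntrinsicDensity (A ⊕ ∁ A) ½ × ¬ HasSomeIntrinsicDensity (A ▷ (A ⊕ ∁ A))
proposition3p6 A hyp = ⊕∁-intrinsic-½ A hyp , ▷-no-intrinsic-density A hyp
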